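{- Let $\sigma$ be a stratified (non-linear) STR type with multiset of linear components $\bar\sigma=[A_1,\dots,A_n]$, and suppose $\Gamma\vdash M:\sigma$ is derivable in STR. Then for each $i$ with $1\le i\le n$ there is a context $\Gamma_i$ such that $\Gamma_i\vdash M:A_i$ is derivable in STR.
   Context: Terms: $M ::= x \mid \lambda x.M \mid MM$ modulo $\alpha$-equivalence. STR types: linear $A ::= a \mid \sigma\multimap A \mid \forall a.A$, stratified $\sigma ::= A \mid \{\sigma_1,\dots,\sigma_n\}$ ($n\ge1$), modulo renaming of bound type variables and the congruence treating $\{\sigma_1,\dots,\sigma_n\}$ as a finite set (no identification of $\{\sigma\}$ with $\sigma$). Multiset of linear components: $\bar A=[A]$ for linear $A$, and $\overline{\{\sigma_1,\dots,\sigma_k\}}=\bar\sigma_1\uplus\dots\uplus\bar\sigma_k$ (multiset union). Contexts are finite partial maps from term variables to types. Rules ($A,B$ linear): (Ax) $x:A\vdash x:A$; (w) from $\Gamma\vdash M:\sigma$, $x\notin dom(\Gamma)$, infer $\Gamma,x:A\vdash M:\sigma$; ($\multimap$I) from $\Gamma,x:\sigma\vdash M:B$ infer $\Gamma\vdash\lambda x.M:\sigma\multimap B$; ($\multimap$E) from $\Gamma_1\vdash M:\sigma\multimap A$, $\Gamma_2\vdash N:\sigma$ with disjoint domains infer $\Gamma_1,\Gamma_2\vdash MN:A$; (m) from $\Gamma,x_1:\sigma_1,\dots,x_n:\sigma_n\vdash M:\tau$ infer $\Gamma,x:\{\sigma_1,\dots,\sigma_n\}\vdash M[x/x_1,\dots,x/x_n]:\tau$;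 (st) from $\Gamma_i\vdash M:\sigma_i$ ($1\le i\le n$), all $\Gamma_i$ with the same domain, infer $\bigcup_i\{\Gamma_i\}\vdash M:\{\sigma_1,\dots,\sigma_n\}$, where $(\bigcup_i\{\Gamma_i\})(x)=\{\Gamma_1(x),\dots,\Gamma_n(x)\}$; ($\forall$I) from $\Gamma\vdash M:A$, $a$ not free in $\Gamma$, infer $\Gamma\vdash M:\forall a.A$; ($\forall$E) from $\Gamma\vdash M:\forall a.B$ infer $\Gamma\vdash M:B[A/a]$, $A$ linear. -}

module Defs where

open import Data.Nat using (ℕ; zero; suc; _≡ᵇ_; _<ᵇ_)
open import Data.Bool using (Bool; true; false; if_then_else_)
open import Data.List using (List; []; _∷_)
open import Data.Bool.ListAction using (any)
open import Data.List.NonEmpty using (List⁺; _∷_; toList) renaming (map to map⁺)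
open import Data.List.Relation.Unary.All using (All)
open import Data.List.Relation.Unary.Any using (Any)
open import Data.List.Relation.Unary.Unique.Propositional using (Unique)
open import Data.List.Relation.Binary.Pointwise using (Pointwise)
open import Data.Maybe using (Maybe; just; nothing)
open import Data.Product using (_×_; _,_; proj₁; proj₂; Σ)
open import Data.Sum using (_⊎_)
open import Relation.Binary.PropositionalEquality using (_≡_)
open import Relation.Nullary using (¬_)

-- Terms, locally nameless: free variables are names (ℕ), bound
-- variables are de Bruijn indices.  This representation is exactly
-- λ-terms modulo α-equivalence (on locally closed terms).

data Tm : Set where
  bvar : ℕ → Tm
  fvar : ℕ → Tm
  lam  : Tm → Tm
  app  : Tm → Tm → Tm

closeTm : ℕ → ℕ → Tm → Tm
closeTm k x (bvar i)  = bvar i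
closeTm k x (fvar y)  = if y ≡ᵇ x then bvar k else fvar y
closeTm k x (lam M)   = lam (closeTm (suc k) x M)
closeTm k x (app M N) = app (closeTm k x M) (closeTm k x N)

renameTm : (ℕ → ℕ) → Tm → Tm
renameTm f (bvar i)  = bvar i
renameTm f (fvar y)  = fvar (f y)
renameTm f (lam M)   = lam (renameTm f M)
renameTm f (app M N) = app (renameTm f M) (renameTm f N)

-- STR types, locally nameless for ∀ (so renaming of bound type
-- variables is built in).  Linear types Lin, stratified types Str.

mutual
  data Lin : Set where
    tfree : ℕ → Lin
    tbnd  : ℕ → Lin
    _⊸_   : Str → Lin → Lin
    all   : Lin → Lin        -- ∀ a. A (body with bound index 0)

  data Str : Set where
    lin : Lin → Str
    set : List⁺ Str → Str

infixr 5 _⊸_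

mutual
  closeL : ℕ → ℕ → Lin → Lin
  closeL k a (tfree b) = if b ≡ᵇ a then tbnd k else tfree b
  closeL k a (tbnd i)  = tbnd i
  closeL k a (σ ⊸ B)   = closeS k a σ ⊸ closeL k a B
  closeL k a (all B)   = all (closeL (suc k) a B)

  closeS : ℕ → ℕ → Str → Str
  closeS k a (lin A)         = lin (closeL k a A)
  closeS k a (set (σ ∷ σs))  = set (closeS k a σ ∷ closeSs k a σs)

  closeSs : ℕ → ℕ → List Str → List Str
  closeSs k a []       = []
  closeSs k a (σ ∷ σs) = closeS k a σ ∷ closeSs k a σs

mutual
  openL : ℕ → Lin → Lin → Lin
  openL k C (tfree b) = tfree b
  openL k C (tbnd i)  = if i ≡ᵇ k then C else tbnd i
  openL k C (σ ⊸ B)   = openS k C σ ⊸ openL k C B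
  openL k C (all B)   = all (openL (suc k) C B)

  openS : ℕ → Lin → Str → Str
  openS k C (lin A)        = lin (openL k C A)
  openS k C (set (σ ∷ σs)) = set (openS k C σ ∷ openSs k C σs)

  openSs : ℕ → Lin → List Str → List Str
  openSs k C []       = []
  openSs k C (σ ∷ σs) = openS k C σ ∷ openSs k C σs

mutual
  data _∈ftvL_ (a : ℕ) : Lin → Set where
    here  : a ∈ftvL tfree a
    arrˡ  : ∀ {σ B} → a ∈ftvS σ → a ∈ftvL (σ ⊸ B)
    arrʳ  : ∀ {σ B} → a ∈ftvL B → a ∈ftvL (σ ⊸ B)
    under : ∀ {B} → a ∈ftvL B → a ∈ftvL all B

  data _∈ftvS_ (a : ℕ) : Str → Set where
    linF : ∀ {A} → a ∈ftvL A → a ∈ftvS lin A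
    setF : ∀ {σs} → Any (a ∈ftvS_) (toList σs) → a ∈ftvS set σs

mutual
  data LcL (k : ℕ) : Lin → Set where
    lcfree : ∀ {a} → LcL k (tfree a)
    lcbnd  : ∀ {i} → (i <ᵇ k) ≡ true → LcL k (tbnd i)
    lc⊸    : ∀ {σ B} → LcS k σ → LcL k B → LcL k (σ ⊸ B)
    lcall  : ∀ {B} → LcL (suc k) B → LcL k (all B)

  data LcS (k : ℕ) : Str → Set where
    lclin : ∀ {A} → LcL k A → LcS k (lin A)
    lcset : ∀ {σs} → All (LcS k) (toList σs) → LcS k (set σs)

-- Type equality: the congruence treating {σ₁,…,σₙ} as a finite set
-- (components compared up to this congruence; order and repetitions
-- irrelevant).  Bound-variable renaming is built into the syntax.
mutual
  data _≈L_ : Lin → Lin → Set where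
    tfree≈ : ∀ {a} → tfree a ≈L tfree a
    tbnd≈  : ∀ {i} → tbnd i ≈L tbnd i
    ⊸≈     : ∀ {σ τ A B} → σ ≈S τ → A ≈L B → (σ ⊸ A) ≈L (τ ⊸ B)
    all≈   : ∀ {A B} → A ≈L B → all A ≈L all B

  data _≈S_ : Str → Str → Set where
    lin≈ : ∀ {A B} → A ≈L B → lin A ≈S lin B
    set≈ : ∀ {σs τs} →
           All (λ σ → Any (σ ≈S_) (toList τs)) (toList σs) →
           All (λ τ → Any (_≈S τ) (toList σs)) (toList τs) →
           set σs ≈S set τs

-- Multiset of linear components  σ̄  (as a list)
mutual
  comps : Str → List Lin
  comps (lin A)        = A ∷ []
  comps (set (σ ∷ σs)) = comps σ ++ compss σs

  compss : List Str → List Lin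
  compss []       = []
  compss (σ ∷ σs) = comps σ ++ compss σs

  _++_ : List Lin → List Lin → List Lin
  [] ++ ys       = ys
  (x ∷ xs) ++ ys = x ∷ (xs ++ ys)

Ctx : Set
Ctx = ℕ → Maybe Str

_∉dom_ : ℕ → Ctx → Set
x ∉dom Γ = Γ x ≡ nothing

sing : ℕ → Str → Ctx
sing x σ y = if y ≡ᵇ x then just σ else nothing

-- Γ , x : σ   (used with the side condition x ∉ dom Γ)
_,_∶_ : Ctx → ℕ → Str → Ctx
(Γ , x ∶ σ) y = if y ≡ᵇ x then just σ else Γ y

extAll : Ctx → List (ℕ × Str) → Ctx
extAll Γ []             = Γ
extAll Γ ((x , σ) ∷ ps) = (extAll Γ ps , x ∶ σ)

Disjoint : Ctx → Ctx → Set
Disjoint Γ₁ Γ₂ = ∀ y → Γ₁ y ≡ nothing ⊎ Γ₂ y ≡ nothing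

_∪_ : Ctx → Ctx → Ctx
(Γ₁ ∪ Γ₂) y with Γ₁ y
... | just σ  = just σ
... | nothing = Γ₂ y

IsStUnion : List⁺ (Ctx × Str) → Ctx → Set
IsStUnion ps Γ = ∀ y →
  (Γ y ≡ nothing × All (λ p → proj₁ p y ≡ nothing) (toList ps))
  ⊎ Σ (List⁺ Str) (λ τs →
      Pointwise (λ p τ → proj₁ p y ≡ just τ) (toList ps) (toList τs)
      × Γ y ≡ just (set τs))

data _≈M_ : Maybe Str → Maybe Str → Set where
  nothing≈ : nothing ≈M nothing
  just≈    : ∀ {σ τ} → σ ≈S τ → just σ ≈M just τ

_≈C_ : Ctx → Ctx → Set
Γ ≈C Δ = ∀ y → Γ y ≈M Δ y

renTo : ℕ → List ℕ → ℕ → ℕ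
renTo x xs y = if any (_≡ᵇ y) xs then x else y

names : List (ℕ × Str) → List ℕ
names []             = []
names ((x , _) ∷ ps) = x ∷ names ps

-- The STR type system.  The rule (≈) expresses that judgements are
-- about types modulo the set congruence.

infix 4 _⊢_∶_
data _⊢_∶_ : Ctx → Tm → Str → Set where
  ax   : ∀ {x A} → LcL 0 A → sing x (lin A) ⊢ fvar x ∶ lin A
  w    : ∀ {Γ M σ x A} → LcL 0 A → Γ ⊢ M ∶ σ → x ∉dom Γ → (Γ , x ∶ lin A) ⊢ M ∶ σ
  ⊸I   : ∀ {Γ M x σ B} → x ∉dom Γ → (Γ , x ∶ σ) ⊢ M ∶ lin B →
         Γ ⊢ lam (closeTm 0 x M) ∶ lin (σ ⊸ B)
  ⊸E   : ∀ {Γ₁ Γ₂ M N σ A} → Γ₁ ⊢ M ∶ lin (σ ⊸ A) → Γ₂ ⊢ N ∶ σ →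
         Disjoint Γ₁ Γ₂ → (Γ₁ ∪ Γ₂) ⊢ app M N ∶ lin A
  m    : ∀ {Γ M τ x} (ps : List⁺ (ℕ × Str)) →
         Unique (names (toList ps)) →
         All (λ p → proj₁ p ∉dom Γ) (toList ps) → x ∉dom Γ →
         extAll Γ (toList ps) ⊢ M ∶ τ →
         (Γ , x ∶ set (map⁺ proj₂ ps)) ⊢ renameTm (renTo x (names (toList ps))) M ∶ τ
  st   : ∀ {Γ M} (ps : List⁺ (Ctx × Str)) →
         All (λ p → proj₁ p ⊢ M ∶ proj₂ p) (toList ps) →
         IsStUnion ps Γ →
         Γ ⊢ M ∶ set (map⁺ proj₂ ps)
  ∀I   : ∀ {Γ M A a} → Γ ⊢ M ∶ lin A →
         (∀ y σ → Γ y ≡ just σ → ¬ (a ∈ftvS σ)) →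
         Γ ⊢ M ∶ lin (all (closeL 0 a A))
  ∀E   : ∀ {Γ M B} (C : Lin) → LcL 0 C → Γ ⊢ M ∶ lin (all B) → Γ ⊢ M ∶ lin (openL 0 C B)
  conv : ∀ {Γ Δ M σ τ} → Γ ⊢ M ∶ σ → Γ ≈C Δ → σ ≈S τ → Δ ⊢ M ∶ τ

-- We prove the stronger statement that Δ can be chosen with dom Δ ⊆ dom Γ,
-- by induction on the derivation.  A stratified type can only be the
-- conclusion of (w), (≈), (st) and (m):
--   * (w) and (≈) shrink the domain or change types up to ≈, and a
--     component of an ≈-equal type is ≈-equal to a component (§ components);
--   * (st) hands A to the premise whose type contributes it; premise
--     domains are exactly dom Γ;
--   * (m) is the real case: the induction hypothesis types M in a context
--     within the domain of Γ,x₁:σ₁,…,xₙ:σₙ, but possibly with some xᵢ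
--     missing or with new types.  We first weaken so that every xᵢ is
--     bound, then read off the new types of the xᵢ and replay (m) with
--     them; the domain invariant guarantees that x is still fresh
--     (§ replaying multiplexing).
module Submission where

open import Defs
open import Data.List.NonEmpty using (List⁺)
open import Data.List.Membership.Propositional using (_∈_)
open import Data.Product using (∃)

open import Data.Nat using (ℕ; _≡ᵇ_)
open import Data.Nat.Properties using (_≟_; ≡ᵇ⇒≡; ≡⇒≡ᵇ)
open import Data.Bool using (true; false; T)
open import Data.List as L using (List; []; _∷_; map)
open import Data.List.NonEmpty using (_∷_; toList) renaming (map to map⁺)
open import Data.List.Relation.Unary.Any using (Any; here; there)
import Data.List.Relation.Unary.Any as Any
open import Data.List.Relation.Unary.Any.Properties using (++⁺ˡ; ++⁺ʳ; ++⁻; map⁻)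
open import Data.List.Relation.Unary.All as All using (All; []; _∷_)
open import Data.List.Relation.Unary.Unique.Propositional using (Unique)
open import Data.List.Membership.Propositional using (_∉_)
open import Data.List.Membership.DecPropositional _≟_ using (_∈?_)
open import Data.Maybe using (Maybe; just; nothing; fromMaybe)
open import Data.Product using (_×_; _,_; proj₁; proj₂)
open import Data.Sum using (inj₁; inj₂)
open import Data.Unit using (tt)
open import Data.Empty using (⊥-elim)
open import Function using (_∘_)
open import Relation.Nullary using (yes; no; contradiction)
open import Relation.Binary.PropositionalEquality
  using (_≡_; _≢_; refl; sym; trans; subst; cong; module ≡-Reasoning)

ext-here : ∀ Γ x σ → (Γ , x ∶ σ) x ≡ just σ
ext-here Γ x σ with x ≡ᵇ x in eq
... | true  = refl
... | false = ⊥-elim (subst T eq (≡⇒≡ᵇ x x refl))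

ext-there : ∀ Γ {x} σ {y} → y ≢ x → (Γ , x ∶ σ) y ≡ Γ y
ext-there Γ {x} σ {y} y≢x with y ≡ᵇ x in eq
... | true  = contradiction (≡ᵇ⇒≡ y x (subst T (sym eq) tt)) y≢x
... | false = refl

_⊆dom_ : Ctx → Ctx → Set
Δ ⊆dom Γ = ∀ y → Γ y ≡ nothing → Δ y ≡ nothing

⊆dom-trans : ∀ {Θ Δ Γ} → Θ ⊆dom Δ → Δ ⊆dom Γ → Θ ⊆dom Γ
⊆dom-trans Θ⊆Δ Δ⊆Γ y Γy = Θ⊆Δ y (Δ⊆Γ y Γy)

ext-⊆dom : ∀ {Δ Γ} x σ τ → Δ ⊆dom Γ → (Δ , x ∶ σ) ⊆dom (Γ , x ∶ τ)
ext-⊆dom {Δ} {Γ} x σ τ Δ⊆Γ y Γy with y ≟ x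
... | yes refl = contradiction (trans (sym (ext-here Γ y τ)) Γy) λ ()
... | no y≢x   =
  trans (ext-there Δ σ y≢x) (Δ⊆Γ y (trans (sym (ext-there Γ τ y≢x)) Γy))

⊆dom-ext : ∀ Γ x σ → Γ ⊆dom (Γ , x ∶ σ)
⊆dom-ext Γ x σ y Γxy with y ≟ x
... | yes refl = contradiction (trans (sym (ext-here Γ y σ)) Γxy) λ ()
... | no y≢x   = trans (sym (ext-there Γ σ y≢x)) Γxy

≈C-⊆dom : ∀ {Γ Δ} → Γ ≈C Δ → Γ ⊆dom Δ
≈C-⊆dom Γ≈Δ y = undefined (Γ≈Δ y)
  where
  undefined : ∀ {μ ν} → μ ≈M ν → ν ≡ nothing → μ ≡ nothing
  undefined nothing≈ refl = refl

diagonal : ∀ {A : Set} {R : A → A → Set} {xs : List A} →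
           All (λ x → R x x) xs → All (λ x → Any (R x) xs) xs
diagonal rs = All.tabulate (λ x∈ → Any.map (λ { refl → All.lookup rs x∈ }) x∈)

mutual
  ≈L-refl : (A : Lin) → A ≈L A
  ≈L-refl (tfree _) = tfree≈
  ≈L-refl (tbnd _)  = tbnd≈
  ≈L-refl (σ ⊸ A)   = ⊸≈ (≈S-refl σ) (≈L-refl A)
  ≈L-refl (all A)   = all≈ (≈L-refl A)

  ≈S-refl : (σ : Str) → σ ≈S σ
  ≈S-refl (lin A)        = lin≈ (≈L-refl A)
  ≈S-refl (set (σ ∷ σs)) = set≈ (diagonal rs) (diagonal rs)
    where rs = ≈S-refl σ ∷ ≈S-reflAll σs

  ≈S-reflAll : (σs : List Str) → All (λ σ → σ ≈S σ) σs
  ≈S-reflAll []       = []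
  ≈S-reflAll (σ ∷ σs) = ≈S-refl σ ∷ ≈S-reflAll σs

≡⇒≈C : ∀ {Γ Δ} → (∀ y → Γ y ≡ Δ y) → Γ ≈C Δ
≡⇒≈C {Γ} Γ≡Δ y = subst (Γ y ≈M_) (Γ≡Δ y) (≈M-refl (Γ y))
  where
  ≈M-refl : (μ : Maybe Str) → μ ≈M μ
  ≈M-refl (just σ) = just≈ (≈S-refl σ)
  ≈M-refl nothing  = nothing≈

++-is-append : (xs ys : List Lin) → xs ++ ys ≡ xs L.++ ys
++-is-append []       ys = refl
++-is-append (x ∷ xs) ys = cong (x ∷_) (++-is-append xs ys)

∈-compss⁻ : ∀ {A} (σs : List Str) → A ∈ compss σs → Any (λ σ → A ∈ comps σ) σs
∈-compss⁻ {A} (σ ∷ σs) A∈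
  with ++⁻ (comps σ) (subst (A ∈_) (++-is-append (comps σ) (compss σs)) A∈)
... | inj₁ A∈σ  = here A∈σ
... | inj₂ A∈σs = there (∈-compss⁻ σs A∈σs)

∈-compss⁺ : ∀ {A} (σs : List Str) → Any (λ σ → A ∈ comps σ) σs → A ∈ compss σs
∈-compss⁺ {A} (σ ∷ σs) A∈ = subst (A ∈_) (sym (++-is-append (comps σ) (compss σs))) (split A∈)
  where
  split : Any (λ σ → A ∈ comps σ) (σ ∷ σs) → A ∈ comps σ L.++ compss σs
  split (here A∈σ)   = ++⁺ˡ A∈σ
  split (there A∈σs) = ++⁺ʳ (comps σ) (∈-compss⁺ σs A∈σs)

mutual
  comps-≈ : ∀ {σ τ A} → σ ≈S τ → A ∈ comps τ → ∃ λ B → B ∈ comps σ × B ≈L A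
  comps-≈ (lin≈ A≈B)          (here refl) = _ , here refl , A≈B
  comps-≈ (set≈ {τs = τs} _ τs⊆σs) A∈     = comps-≈-all τs⊆σs (∈-compss⁻ (toList τs) A∈)

  comps-≈-all : ∀ {σs τs A} → All (λ τ → Any (_≈S τ) σs) τs →
                Any (λ τ → A ∈ comps τ) τs → ∃ λ B → B ∈ compss σs × B ≈L A
  comps-≈-all {σs} (τ∈σs ∷ _) (here A∈τ) = comps-≈-any σs τ∈σs A∈τ
  comps-≈-all (_ ∷ τs⊆σs) (there A∈)     = comps-≈-all τs⊆σs A∈

  comps-≈-any : ∀ {τ A} σs → Any (_≈S τ) σs → A ∈ comps τ →
                ∃ λ B → B ∈ compss σs × B ≈L A
  comps-≈-any (σ ∷ σs) (here σ≈τ) A∈τ with comps-≈ σ≈τ A∈τ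
  ... | B , B∈σ , B≈A = B , ∈-compss⁺ (σ ∷ σs) (here B∈σ) , B≈A
  comps-≈-any (σ ∷ σs) (there τ∈σs) A∈τ with comps-≈-any σs τ∈σs A∈τ
  ... | B , B∈σs , B≈A = B , ∈-compss⁺ (σ ∷ σs) (there (∈-compss⁻ σs B∈σs)) , B≈A

st-premise-⊆dom : ∀ {ps Γ q} → IsStUnion ps Γ → q ∈ toList ps → proj₁ q ⊆dom Γ
st-premise-⊆dom U q∈ y Γy with U y
... | inj₁ (_ , premises) = All.lookup premises q∈
... | inj₂ (_ , _ , Γy≡set) = contradiction (trans (sym Γy≡set) Γy) λ ()

_∖_ : Ctx → List ℕ → Ctx
(Γ ∖ ns) y with y ∈? ns
... | yes _ = nothing
... | no _  = Γ y

∖-in : ∀ {Γ ns y} → y ∈ ns → (Γ ∖ ns) y ≡ nothing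
∖-in {Γ} {ns} {y} y∈ with y ∈? ns
... | yes _  = refl
... | no y∉ = contradiction y∈ y∉

∖-out : ∀ {Γ ns y} → y ∉ ns → (Γ ∖ ns) y ≡ Γ y
∖-out {Γ} {ns} {y} y∉ with y ∈? ns
... | yes y∈ = contradiction y∈ y∉
... | no _   = refl

∖-nothing : ∀ {Γ} ns y → (y ∉ ns → Γ y ≡ nothing) → (Γ ∖ ns) y ≡ nothing
∖-nothing ns y outside with y ∈? ns
... | yes _  = refl
... | no y∉ = outside y∉

extAll-outside : ∀ {Γ y} (qs : List (ℕ × Str)) → y ∉ names qs → extAll Γ qs y ≡ Γ y
extAll-outside []              y∉ = refl
extAll-outside {Γ} ((x , σ) ∷ qs) y∉ =
  trans (ext-there (extAll Γ qs) σ (y∉ ∘ here)) (extAll-outside qs (y∉ ∘ there))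

names-∈ : (qs : List (ℕ × Str)) → All (λ q → proj₁ q ∈ names qs) qs
names-∈ []       = []
names-∈ (_ ∷ qs) = here refl ∷ All.map there (names-∈ qs)

retype : (ℕ → Str) → ℕ × Str → ℕ × Str
retype f (x , _) = x , f x

names-retype : ∀ f (qs : List (ℕ × Str)) → names (map (retype f) qs) ≡ names qs
names-retype f []             = refl
names-retype f ((x , _) ∷ qs) = cong (x ∷_) (names-retype f qs)

extAll-retype : ∀ f {Γ y} (qs : List (ℕ × Str)) → y ∈ names qs →
                extAll Γ (map (retype f) qs) y ≡ just (f y)
extAll-retype f {Γ} {y} ((x , _) ∷ qs) y∈ with y ≟ x | y∈
... | yes refl | _        = ext-here (extAll Γ (map (retype f) qs)) y (f y)
... | no y≢x   | here y≡x = contradiction y≡x y≢x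
... | no y≢x   | there y∈qs =
  trans (ext-there (extAll Γ (map (retype f) qs)) (f x) y≢x) (extAll-retype f qs y∈qs)

Covers : List ℕ → Ctx → Set
Covers ns Δ = ∀ {y} → y ∈ ns → ∃ λ τ → Δ y ≡ just τ

coverName : ∀ {Γ M τ} n → Γ ⊢ M ∶ τ →
            ∃ λ Δ → Δ ⊢ M ∶ τ × (∃ λ ρ → Δ n ≡ just ρ) × (∀ y → y ≢ n → Δ y ≡ Γ y)
coverName {Γ} n d with Γ n in Γn
... | just ρ  = Γ , d , (ρ , Γn) , λ _ _ → refl
... | nothing = (Γ , n ∶ lin (tfree 0)) , w lcfree d Γn
              , (_ , ext-here Γ n _) , λ _ y≢n → ext-there Γ _ y≢n

coverNames : ∀ {Γ M τ} ns → Γ ⊢ M ∶ τ →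
             ∃ λ Δ → Δ ⊢ M ∶ τ × Covers ns Δ × (∀ y → y ∉ ns → Δ y ≡ Γ y)
coverNames []       d = _ , d , (λ ()) , λ _ _ → refl
coverNames (n ∷ ns) d with coverNames ns d
... | Δ , dΔ , covΔ , outΔ with coverName n dΔ
...   | Θ , dΘ , (ρ , Θn) , outΘ = Θ , dΘ , covΘ , outΘ′
  where
  covΘ : Covers (n ∷ ns) Θ
  covΘ (here refl) = ρ , Θn
  covΘ {y} (there y∈) with y ≟ n
  ... | yes refl = ρ , Θn
  ... | no y≢n   = let (ρ′ , Δy) = covΔ y∈ in ρ′ , trans (outΘ y y≢n) Δy
  outΘ′ : ∀ y → y ∉ n ∷ ns → Θ y ≡ _
  outΘ′ y y∉ = trans (outΘ y (y∉ ∘ here)) (outΔ y (y∉ ∘ there))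

-- The type Δ assigns to a name (arbitrary if unbound).
typeIn : Ctx → ℕ → Str
typeIn Δ y = fromMaybe (lin (tfree 0)) (Δ y)

splitOff : ∀ {Δ} (qs : List (ℕ × Str)) → Covers (names qs) Δ →
           ∀ y → Δ y ≡ extAll (Δ ∖ names qs) (map (retype (typeIn Δ)) qs) y
splitOff {Δ} qs cov y with y ∈? names qs
... | yes y∈ = begin
  Δ y                  ≡⟨ Δy ⟩
  just ρ               ≡⟨ cong (just ∘ fromMaybe _) (sym Δy) ⟩
  just (typeIn Δ y)    ≡⟨ sym (extAll-retype (typeIn Δ) qs y∈) ⟩
  extAll _ (map (retype (typeIn Δ)) qs) y ∎
  where
  open ≡-Reasoning
  ρ  = proj₁ (cov y∈)
  Δy = proj₂ (cov y∈)
... | no y∉ = sym (trans (extAll-outside (map (retype (typeIn Δ)) qs)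
                           (y∉ ∘ subst (y ∈_) (names-retype (typeIn Δ) qs)))
                         (∖-out y∉))

remultiplex : ∀ {Γ Γ′ M τ x} (ps : List⁺ (ℕ × Str)) → Unique (names (toList ps)) →
              x ∉dom Γ → Γ′ ⊢ M ∶ τ → Γ′ ⊆dom extAll Γ (toList ps) →
              ∃ λ Δ → Δ ⊢ renameTm (renTo x (names (toList ps))) M ∶ τ
                    × Δ ⊆dom (Γ , x ∶ set (map⁺ proj₂ ps))
remultiplex {Γ} {Γ′} {M} {τ} {x} ps unique x∉Γ d Γ′⊆ with coverNames (names (toList ps)) d
... | Θ , dΘ , covΘ , outΘ =
  (Θ₀ , x ∶ set (map⁺ proj₂ ps′)) , renamed , ext-⊆dom x _ _ restricted
  where
  ns  = names (toList ps)
  ps′ = map⁺ (retype (typeIn Θ)) ps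
  Θ₀  = Θ ∖ ns

  names≡ : names (toList ps′) ≡ ns
  names≡ = names-retype (typeIn Θ) (toList ps)

  -- outside ns, Θ₀ agrees with Γ′ and hence binds nothing Γ leaves unbound
  restricted : Θ₀ ⊆dom Γ
  restricted y Γy = ∖-nothing ns y λ y∉ →
    trans (outΘ y y∉) (Γ′⊆ y (trans (extAll-outside (toList ps) y∉) Γy))

  fresh : All (λ q → proj₁ q ∉dom Θ₀) (toList ps′)
  fresh = All.map (λ {q} q∈ → ∖-in {Θ} {ns} (subst (proj₁ q ∈_) names≡ q∈)) (names-∈ (toList ps′))

  premise : extAll Θ₀ (toList ps′) ⊢ M ∶ τ
  premise = conv dΘ (≡⇒≈C (splitOff (toList ps) covΘ)) (≈S-refl τ)

  renamed : (Θ₀ , x ∶ set (map⁺ proj₂ ps′)) ⊢ renameTm (renTo x ns) M ∶ τ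
  renamed = subst (λ ms → (Θ₀ , x ∶ set (map⁺ proj₂ ps′)) ⊢ renameTm (renTo x ms) M ∶ τ) names≡
                  (m ps′ (subst Unique (sym names≡) unique) fresh (restricted x x∉Γ) premise)

Component : Ctx → Tm → Lin → Set
Component Γ M A = ∃ λ Δ → Δ ⊢ M ∶ lin A × Δ ⊆dom Γ

enlarge : ∀ {Γ Γ′ M A} → Γ ⊆dom Γ′ → Component Γ M A → Component Γ′ M A
enlarge Γ⊆Γ′ (Δ , d , Δ⊆Γ) = Δ , d , ⊆dom-trans Δ⊆Γ Γ⊆Γ′

convert : ∀ {Γ M A B} → B ≈L A → Component Γ M B → Component Γ M A
convert B≈A (Δ , d , Δ⊆Γ) = Δ , conv d (≡⇒≈C λ _ → refl) (lin≈ B≈A) , Δ⊆Γ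

mutual
  component : ∀ {Γ M σ A} → Γ ⊢ M ∶ σ → A ∈ comps σ → Component Γ M A
  component {σ = lin _} d (here refl) = _ , d , λ _ Γy → Γy
  component {σ = set _} (w {Γ} {x = x} _ d _) A∈ = enlarge (⊆dom-ext Γ x _) (component d A∈)
  component {σ = set _} (conv d Γ≈Δ σ≈τ) A∈ with comps-≈ σ≈τ A∈
  ... | B , B∈ , B≈A = enlarge (≈C-⊆dom Γ≈Δ) (convert B≈A (component d B∈))
  component {σ = set _} (st ps ds U) A∈ =
    fromPremise ds (All.tabulate (st-premise-⊆dom U)) (map⁻ (∈-compss⁻ _ A∈))
  component {σ = set _} (m ps unique _ x∉Γ d) A∈ with component d A∈
  ... | Δ , dΔ , Δ⊆ = remultiplex ps unique x∉Γ dΔ Δ⊆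

  fromPremise : ∀ {Γ M A} {qs : List (Ctx × Str)} →
                All (λ q → proj₁ q ⊢ M ∶ proj₂ q) qs → All (λ q → proj₁ q ⊆dom Γ) qs →
                Any (λ q → A ∈ comps (proj₂ q)) qs → Component Γ M A
  fromPremise (d ∷ _)  (q⊆ ∷ _)  (here A∈)  = enlarge q⊆ (component d A∈)
  fromPremise (_ ∷ ds) (_ ∷ q⊆s) (there A∈) = fromPremise ds q⊆s A∈

mainTheorem14 : (Γ : Ctx) (M : Tm) (σs : List⁺ Str) (A : Lin) →
                Γ ⊢ M ∶ set σs → A ∈ comps (set σs) →
                ∃ λ (Γ′ : Ctx) → Γ′ ⊢ M ∶ lin A
mainTheorem14 Γ M σs A d A∈ = let (Δ , dΔ , _) = component d A∈ in Δ , dΔ
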